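{- Let $f\ge 2$ and $k\ge 1$ be integers. Every pattern with at most $k$ variables and length at least $f\times 2^{k-1}$ contains, as a factor, a balanced pattern $p'$ with at most $k'$ variables and length at least $f\times 2^{k'-1}$, for some integer $k'\ge 1$.
   Context: A pattern is a non-empty finite word over an alphabet of symbols called variables; its length is its number of letters, and a factor is a contiguous subword. A pattern $p$ is doubled if every variable occurring in $p$ occurs at least twice in $p$. A pattern $p$ is balanced if it is doubled and every variable of $p$ occurs both in the prefix of length $\lfloor |p|/2\rfloor$ and in the suffix of length $\lfloor |p|/2\rfloor$ of $p$. -}

module Defs where

open import Data.Nat using (ℕ; _≤_; _/_; _∸_)
open import Data.Nat.Properties using (_≟_)
open import Data.List using (List; []; length; deduplicate; filter; take; drop; _++_)
open import Data.List.Membership.Propositional using (_∈_)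
open import Data.Product using (_×_; ∃₂)
open import Relation.Binary.PropositionalEquality using (_≡_)

-- Variables are natural numbers; a pattern is a (non-empty) list of variables.
Pattern : Set
Pattern = List ℕ

numVars : Pattern → ℕ
numVars p = length (deduplicate _≟_ p)

Factor : Pattern → Pattern → Set
Factor q p = ∃₂ λ u v → p ≡ u ++ q ++ v

occ : ℕ → Pattern → ℕ
occ x p = length (filter (x ≟_) p)

Doubled : Pattern → Set
Doubled p = ∀ x → x ∈ p → 2 ≤ occ x p

half : Pattern → ℕ
half p = length p / 2

Balanced : Pattern → Set
Balanced p = Doubled p ×
  (∀ x → x ∈ p → (x ∈ take (half p) p) × (x ∈ drop (length p ∸ half p) p))

module Submission where

-- We prove a stronger statement by induction on m: if every
-- variable of p lies in an alphabet V with |V| ≤ m + 1 and |p| ≥ f·2^m,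
-- then p has a balanced factor p' with at most k' variables and length at
-- least f·2^(k'-1) for some k' ≥ 1.
--   * m = 0: p uses a single variable and |p| ≥ f ≥ 2; a constant pattern
--     of length at least 2 is balanced, so p itself works with k' = 1.
--   * m + 1: put h = f·2^m and cut the prefix q of p of length 2h into its
--     halves A and B.  If every variable of q occurs in both halves, q is
--     balanced and works with k' = m + 2.  Otherwise some variable x of q
--     is missing from A or from B; that half has length h and lives over
--     the smaller alphabet V ∖ {x}, so the induction hypothesis applies.

open import Defs
open import Data.Nat using (ℕ; zero; suc; _+_; _*_; _^_; _∸_; _≤_; _<_; z≤n; s≤s; _/_)
open import Data.Nat.Properties
open import Data.Nat.DivMod using (m*n/n≡m; m/n≤m; m≥n⇒m/n>0)
open import Data.List using (List; []; _∷_; length; take; drop; filter; _++_; deduplicate)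
open import Data.List.Properties
  using (length-take; length-drop; take++drop≡id; ++-assoc; ++-identityʳ;
         length-++; filter-++; filter-all; filter-notAll)
open import Data.List.Membership.Propositional using (_∈_; _∉_; find)
open import Data.List.Membership.Propositional.Properties
  using (∈-++⁺ˡ; ∈-++⁺ʳ; ∈-filter⁺; ∈-deduplicate⁺; ∈-deduplicate⁻)
open import Data.List.Membership.DecPropositional _≟_ using (_∈?_)
open import Data.List.Relation.Binary.Subset.Propositional using (_⊆_)
open import Data.List.Relation.Unary.Any as Any using (here; there)
open import Data.List.Relation.Unary.All as All using (All; all?)
open import Data.List.Relation.Unary.All.Properties using (¬All⇒Any¬)
open import Data.List.Relation.Unary.AllPairs using (_∷_)
open import Data.List.Relation.Unary.Unique.DecPropositional _≟_ using (Unique)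
open import Data.List.Relation.Unary.Unique.DecPropositional.Properties _≟_ using (deduplicate-!)
open import Data.Product using (_×_; Σ; ∃; _,_; proj₁; proj₂)
open import Data.Sum using (_⊎_; inj₁; inj₂)
open import Relation.Nullary using (Dec; yes; no; ¬_; ¬?)
open import Relation.Nullary.Decidable using (_×-dec_)
open import Relation.Binary.PropositionalEquality
  using (_≢_; _≡_; refl; sym; trans; cong; cong₂; subst; module ≡-Reasoning)

HasBalancedFactor : ℕ → Pattern → Set
HasBalancedFactor f p = ∃ λ k' → 1 ≤ k' × Σ Pattern λ p' → p' ≢ [] × Factor p' p ×
  Balanced p' × numVars p' ≤ k' × f * 2 ^ (k' ∸ 1) ≤ length p'

nonEmpty : (p : Pattern) → 1 ≤ length p → p ≢ []
nonEmpty (_ ∷ _) _ ()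

∈⇒1≤length : ∀ {x} {ys : List ℕ} → x ∈ ys → 1 ≤ length ys
∈⇒1≤length (here _)  = s≤s z≤n
∈⇒1≤length (there _) = s≤s z≤n

length-take-≤ : ∀ n (p : Pattern) → n ≤ length p → length (take n p) ≡ n
length-take-≤ n p n≤ = trans (length-take n p) (m≤n⇒m⊓n≡m n≤)

factor-trans : ∀ {r q p} → Factor r q → Factor q p → Factor r p
factor-trans {r} (u' , v' , refl) (u , v , refl) = u ++ u' , v' ++ v , regroup
  where
  open ≡-Reasoning
  regroup : u ++ (u' ++ r ++ v') ++ v ≡ (u ++ u') ++ r ++ v' ++ v
  regroup = begin
    u ++ (u' ++ r ++ v') ++ v   ≡⟨ cong (u ++_) (++-assoc u' (r ++ v') v) ⟩
    u ++ u' ++ (r ++ v') ++ v   ≡⟨ cong (λ w → u ++ u' ++ w) (++-assoc r v' v) ⟩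
    u ++ u' ++ r ++ v' ++ v     ≡⟨ sym (++-assoc u u' (r ++ v' ++ v)) ⟩
    (u ++ u') ++ r ++ v' ++ v   ∎

factor-⊆ : ∀ {q p} → Factor q p → q ⊆ p
factor-⊆ (u , _ , refl) x∈q = ∈-++⁺ʳ u (∈-++⁺ˡ x∈q)

factor-take : ∀ n (p : Pattern) → Factor (take n p) p
factor-take n p = [] , drop n p , sym (take++drop≡id n p)

factor-drop : ∀ n (p : Pattern) → Factor (drop n p) p
factor-drop n p = take n p , [] , (begin
  p                           ≡⟨ sym (take++drop≡id n p) ⟩
  take n p ++ drop n p        ≡⟨ cong (take n p ++_) (sym (++-identityʳ (drop n p))) ⟩
  take n p ++ drop n p ++ []  ∎)
  where open ≡-Reasoning

lift-factor : ∀ {f r p} → Factor r p → HasBalancedFactor f r → HasBalancedFactor f p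
lift-factor r⊑p (k' , 1≤k' , p' , p'≢[] , p'⊑r , bal , vars , len) =
  k' , 1≤k' , p' , p'≢[] , factor-trans p'⊑r r⊑p , bal , vars , len

occ-++ : ∀ x a b → occ x (a ++ b) ≡ occ x a + occ x b
occ-++ x a b = trans (cong length (filter-++ (x ≟_) a b))
                     (length-++ (filter (x ≟_) a))

occ-∈ : ∀ x a → x ∈ a → 1 ≤ occ x a
occ-∈ x a x∈a = ∈⇒1≤length (∈-filter⁺ (x ≟_) x∈a refl)

occ-constant : ∀ x (p : Pattern) → All (x ≡_) p → occ x p ≡ length p
occ-constant x p all≡ = cong length (filter-all (x ≟_) all≡)

without : ℕ → List ℕ → List ℕ
without x = filter (λ y → ¬? (x ≟ y))

length-without : ∀ {x} V → x ∈ V → length (without x V) < length V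
length-without V x∈V = filter-notAll (λ y → ¬? (_ ≟ y)) V (Any.map (λ x≡y x≢y → x≢y x≡y) x∈V)

⊆-without : ∀ {x q V} → q ⊆ V → x ∉ q → q ⊆ without x V
⊆-without q⊆V x∉q y∈q = ∈-filter⁺ (λ z → ¬? (_ ≟ z)) (q⊆V y∈q) (λ { refl → x∉q y∈q })

unique-⊆-length : (xs V : List ℕ) → Unique xs → xs ⊆ V → length xs ≤ length V
unique-⊆-length []       V _               _    = z≤n
unique-⊆-length (x ∷ xs) V (x∉xs ∷ uniq) xs⊆V = begin
  suc (length xs)            ≤⟨ s≤s (unique-⊆-length xs (without x V) uniq rest⊆) ⟩
  suc (length (without x V)) ≤⟨ length-without V (xs⊆V (here refl)) ⟩
  length V                   ∎
  where
  open ≤-Reasoning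
  rest⊆ : xs ⊆ without x V
  rest⊆ = ⊆-without (λ y∈xs → xs⊆V (there y∈xs)) (λ x∈xs → All.lookup x∉xs x∈xs refl)

numVars-≤ : ∀ {p V} → p ⊆ V → numVars p ≤ length V
numVars-≤ {p} {V} p⊆V =
  unique-⊆-length (deduplicate _≟_ p) V (deduplicate-! p) (λ x∈ → p⊆V (∈-deduplicate⁻ _≟_ p x∈))

balanced-halves : (q : Pattern) (h : ℕ) → length q ≡ h + h →
  (∀ x → x ∈ q → x ∈ take h q × x ∈ drop h q) → Balanced q
balanced-halves q h len both = doubled , halves
  where
  half≡h : half q ≡ h
  half≡h = begin
    length q / 2  ≡⟨ cong (_/ 2) len ⟩
    (h + h) / 2   ≡⟨ cong (λ n → (h + n) / 2) (sym (+-identityʳ h)) ⟩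
    (2 * h) / 2   ≡⟨ cong (_/ 2) (*-comm 2 h) ⟩
    (h * 2) / 2   ≡⟨ m*n/n≡m h 2 ⟩
    h             ∎
    where open ≡-Reasoning
  rest≡h : length q ∸ half q ≡ h
  rest≡h = trans (cong₂ _∸_ len half≡h) (m+n∸n≡m h h)
  doubled : Doubled q
  doubled x x∈q = subst (λ r → 2 ≤ occ x r) (take++drop≡id h q)
    (subst (2 ≤_) (sym (occ-++ x (take h q) (drop h q)))
      (+-mono-≤ (occ-∈ x _ (proj₁ (both x x∈q))) (occ-∈ x _ (proj₂ (both x x∈q)))))
  halves : ∀ x → x ∈ q → x ∈ take (half q) q × x ∈ drop (length q ∸ half q) q
  halves x x∈q = subst (λ n → x ∈ take n q) (sym half≡h) (proj₁ (both x x∈q))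
               , subst (λ n → x ∈ drop n q) (sym rest≡h) (proj₂ (both x x∈q))

∈-constant : ∀ {v} (r : Pattern) → r ⊆ (v ∷ []) → 1 ≤ length r → v ∈ r
∈-constant (y ∷ _) r⊆v _ with r⊆v (here refl)
... | here y≡v = here (sym y≡v)

balanced-constant : ∀ {v} (p : Pattern) → p ⊆ (v ∷ []) → 2 ≤ length p → Balanced p
balanced-constant {v} p p⊆v 2≤len = doubled , halves
  where
  is-v : ∀ {x} → x ∈ p → x ≡ v
  is-v x∈p with p⊆v x∈p
  ... | here x≡v = x≡v
  half≤len : half p ≤ length p
  half≤len = m/n≤m (length p) 2
  1≤half : 1 ≤ half p
  1≤half = m≥n⇒m/n>0 2≤len
  doubled : Doubled p
  doubled x x∈p = subst (2 ≤_) (sym (occ-constant x p all-x)) 2≤len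
    where
    all-x : All (x ≡_) p
    all-x = All.tabulate (λ y∈p → trans (is-v x∈p) (sym (is-v y∈p)))
  front : v ∈ take (half p) p
  front = ∈-constant _ (λ y∈ → p⊆v (factor-⊆ (factor-take (half p) p) y∈))
            (subst (1 ≤_) (sym (length-take-≤ (half p) p half≤len)) 1≤half)
  back : v ∈ drop (length p ∸ half p) p
  back = ∈-constant _ (λ y∈ → p⊆v (factor-⊆ (factor-drop (length p ∸ half p) p) y∈))
           (subst (1 ≤_) (sym (trans (length-drop (length p ∸ half p) p) (m∸[m∸n]≡n half≤len))) 1≤half)
  halves : ∀ x → x ∈ p → x ∈ take (half p) p × x ∈ drop (length p ∸ half p) p
  halves x x∈p rewrite is-v x∈p = front , back

f*2^suc : ∀ f m → f * 2 ^ suc m ≡ f * 2 ^ m + f * 2 ^ m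
f*2^suc f m = begin
  f * (2 * 2 ^ m)                ≡⟨ *-distribˡ-+ f (2 ^ m) (2 ^ m + 0) ⟩
  f * 2 ^ m + f * (2 ^ m + 0)    ≡⟨ cong (λ n → f * 2 ^ m + f * n) (+-identityʳ (2 ^ m)) ⟩
  f * 2 ^ m + f * 2 ^ m          ∎
  where open ≡-Reasoning

all-or-counterexample : ∀ {P : ℕ → Set} → (∀ x → Dec (P x)) → (q : List ℕ) →
  (∀ x → x ∈ q → P x) ⊎ ∃ λ x → x ∈ q × ¬ P x
all-or-counterexample P? q with all? P? q
... | yes all = inj₁ (λ _ x∈q → All.lookup all x∈q)
... | no ¬all = inj₂ (find (¬All⇒Any¬ P? q ¬all))

balanced-or-missing : (q : Pattern) (h : ℕ) → length q ≡ h + h →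
  Balanced q ⊎ Σ Pattern (λ r → Factor r q × length r ≡ h × ∃ λ x → x ∈ q × x ∉ r)
balanced-or-missing q h len
  with all-or-counterexample (λ x → (x ∈? take h q) ×-dec (x ∈? drop h q)) q
... | inj₁ inBoth = inj₁ (balanced-halves q h len inBoth)
... | inj₂ (x , x∈q , ¬inBoth) with x ∈? take h q
...     | yes x∈A = inj₂ (drop h q , factor-drop h q , |B| , x , x∈q , λ x∈B → ¬inBoth (x∈A , x∈B))
  where
  |B| : length (drop h q) ≡ h
  |B| = trans (length-drop h q) (trans (cong (_∸ h) len) (m+n∸n≡m h h))
...     | no x∉A = inj₂ (take h q , factor-take h q , |A| , x , x∈q , x∉A)
  where
  |A| : length (take h q) ≡ h
  |A| = length-take-≤ h q (subst (h ≤_) (sym len) (m≤m+n h h))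

BoundAt : ℕ → ℕ → Set
BoundAt f m = ∀ (V p : Pattern) → p ⊆ V → length V ≤ suc m → f * 2 ^ m ≤ length p →
  HasBalancedFactor f p

single-letter : ∀ {p : Pattern} V → p ⊆ V → length V ≤ 1 → 1 ≤ length p → ∃ λ v → p ⊆ v ∷ []
single-letter {y ∷ _} []          p⊆[] _       _ with p⊆[] (here refl)
... | ()
single-letter         (v ∷ [])    p⊆v  _       _ = v , p⊆v
single-letter         (_ ∷ _ ∷ _) _    (s≤s ()) _

bound-zero : ∀ f → 2 ≤ f → BoundAt f 0
bound-zero f 2≤f V p p⊆V |V|≤1 f≤|p| =
  1 , ≤-refl , p , nonEmpty p 1≤|p| , ([] , [] , sym (++-identityʳ p)) ,
  balanced-constant p (proj₂ constant) 2≤|p| , ≤-trans (numVars-≤ p⊆V) |V|≤1 , f≤|p|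
  where
  2≤|p| : 2 ≤ length p
  2≤|p| = ≤-trans 2≤f (subst (_≤ length p) (*-identityʳ f) f≤|p|)
  1≤|p| : 1 ≤ length p
  1≤|p| = ≤-trans (s≤s z≤n) 2≤|p|
  constant : ∃ λ v → p ⊆ v ∷ []
  constant = single-letter V p⊆V |V|≤1 1≤|p|

bound-suc : ∀ f m → 2 ≤ f → BoundAt f m → BoundAt f (suc m)
bound-suc f m 2≤f bound V p p⊆V |V|≤ 2h≤|p| = conclude (balanced-or-missing q h |q|)
  where
  h = f * 2 ^ m
  q = take (h + h) p
  |q| : length q ≡ h + h
  |q| = length-take-≤ (h + h) p (subst (_≤ length p) (f*2^suc f m) 2h≤|p|)
  q⊑p : Factor q p
  q⊑p = factor-take (h + h) p
  q⊆V : q ⊆ V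
  q⊆V x∈q = p⊆V (factor-⊆ q⊑p x∈q)
  1≤h : 1 ≤ h
  1≤h = *-mono-≤ (≤-trans (s≤s z≤n) 2≤f) (m^n>0 2 m)
  conclude : Balanced q ⊎ Σ Pattern (λ r → Factor r q × length r ≡ h × ∃ λ x → x ∈ q × x ∉ r) →
    HasBalancedFactor f p
  conclude (inj₁ balanced) =
    suc (suc m) , s≤s z≤n , q , nonEmpty q (subst (1 ≤_) (sym |q|) (≤-trans 1≤h (m≤m+n h h))) ,
    q⊑p , balanced , ≤-trans (numVars-≤ q⊆V) |V|≤ ,
    ≤-reflexive (trans (f*2^suc f m) (sym |q|))
  conclude (inj₂ (r , r⊑q , |r| , x , x∈q , x∉r)) =
    lift-factor {f} (factor-trans r⊑q q⊑p)
      (bound (without x V) r (⊆-without (λ y∈r → q⊆V (factor-⊆ r⊑q y∈r)) x∉r)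
             (≤-pred (≤-trans (length-without V (q⊆V x∈q)) |V|≤))
             (≤-reflexive (sym |r|)))

bound : ∀ f → 2 ≤ f → ∀ m → BoundAt f m
bound f 2≤f zero    = bound-zero f 2≤f
bound f 2≤f (suc m) = bound-suc f m 2≤f (bound f 2≤f m)

-- The theorem: apply the bound at level k - 1 to p over its own set of
-- variables, whose size is numVars p.
claim1 : (f k : ℕ) → 2 ≤ f → 1 ≤ k → (p : Pattern) → p ≢ [] →
    numVars p ≤ k → f * 2 ^ (k ∸ 1) ≤ length p →
    ∃ λ k' → 1 ≤ k' × Σ Pattern λ p' → p' ≢ [] × Factor p' p × Balanced p' ×
    numVars p' ≤ k' × f * 2 ^ (k' ∸ 1) ≤ length p'
claim1 f (suc m) 2≤f _ p _ vars len =
  bound f 2≤f m (deduplicate _≟_ p) p (∈-deduplicate⁺ _≟_) vars len
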